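{- For every non-negative integer $n$ and every integer $s$, \[ 2\sum_{k = 0}^{\lfloor n/2 \rfloor} \binom {n}{2k} \frac{F_{6k + s}}{9^k} = \left(\frac23\right)^{n} \begin{cases} (-1)^{s+1} F_{n - s} + 5^{n/2}F_{n+s}, & \text{$n$ even;}\\ (-1)^{s+1} F_{n - s} + 5^{(n-1)/2}L_{n+s}, & \text{$n$ odd,} \end{cases} \] \[ 2\sum_{ k = 0}^{\lfloor n/2 \rfloor} \binom {n}{2k} \frac{L_{6k + s}}{9^k} =\left(\frac23\right)^{n} \begin{cases} (-1)^s L_{n - s} + 5^{n/2}L_{n+s}, & \text{$n$ even;}\\ (-1)^s L_{n - s} + 5^{(n+1)/2}F_{n+s}, & \text{$n$ odd.} \end{cases} \]
   Context: The Fibonacci numbers $F_j$ and Lucas numbers $L_j$ are defined for all integers $j$ by $F_0=0$, $F_1=1$, $L_0=2$, $L_1=1$, $F_j=F_{j-1}+F_{j-2}$, $L_j=L_{j-1}+L_{j-2}$, with $F_{ -j}=(-1)^{j-1}F_j$ and $L_{ -j}=(-1)^jL_j$. -}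

module Defs where

open import Data.Nat as ℕ using (ℕ; zero; suc)
open import Data.Integer as ℤ using (ℤ; +_; -[1+_])
open import Data.Rational as ℚ using (ℚ; _/_)

fibℕ : ℕ → ℕ
fibℕ 0 = 0
fibℕ 1 = 1
fibℕ (suc (suc n)) = fibℕ (suc n) ℕ.+ fibℕ n

lucℕ : ℕ → ℕ
lucℕ 0 = 2
lucℕ 1 = 1
lucℕ (suc (suc n)) = lucℕ (suc n) ℕ.+ lucℕ n

sgn : ℕ → ℤ
sgn zero = + 1
sgn (suc m) = ℤ.- sgn m

-- Extension to all integers: F_{-j} = (-1)^{j-1} F_j, L_{-j} = (-1)^j L_j
F : ℤ → ℤ
F (+ n) = + fibℕ n
F -[1+ m ] = sgn m ℤ.* + fibℕ (suc m)

L : ℤ → ℤ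
L (+ n) = + lucℕ n
L -[1+ m ] = sgn (suc m) ℤ.* + lucℕ (suc m)

sgnℤ : ℤ → ℤ
sgnℤ (+ n) = sgn n
sgnℤ -[1+ m ] = sgn (suc m)

_^ℚ_ : ℚ → ℕ → ℚ
q ^ℚ zero = ℚ.1ℚ
q ^ℚ suc n = q ℚ.* (q ^ℚ n)

sumTo : ℕ → (ℕ → ℚ) → ℚ
sumTo zero f = f 0
sumTo (suc m) f = sumTo m f ℚ.+ f (suc m)

ι : ℤ → ℚ
ι z = z / 1

if-parity : {A : Set} → ℕ → A → A → A
if-parity zero a b = a
if-parity (suc zero) a b = b
if-parity (suc (suc n)) a b = if-parity n a b

-- With t = 1/3 and h ∈ {F, L}, twice the even-index sum is A + B with
--   A = Σⱼ C(n,j) h(3j+s) tʲ  and  B = Σⱼ C(n,j) h(3j+s) (-t)ʲ,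
-- since 1 + (-1)ʲ kills the odd terms.  By Pascal's rule A = (2/3)ⁿ cₙ(s) and
-- B = (2/3)ⁿ dₙ(s) for any c, d with c₀ = d₀ = h and
--   2 cₙ₊₁(s) = 3 cₙ(s) + cₙ(s+3),   2 dₙ₊₁(s) = 3 dₙ(s) - dₙ(s+3).
-- For h = F these are cₙ(s) = 5^⌊n/2⌋ F(n+s) or 5^⌊n/2⌋ L(n+s) according to the parity
-- of n, and dₙ(s) = (-1)^(s+1) F(n-s); similarly for h = L.  The recurrences reduce to
--   3Fₘ + Fₘ₊₃ = 2Lₘ₊₁,  3Lₘ + Lₘ₊₃ = 10Fₘ₊₁,  3Fₘ + Fₘ₋₃ = 2Fₘ₊₁,  3Lₘ + Lₘ₋₃ = 2Lₘ₊₁,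
-- each true because both sides satisfy the Fibonacci recurrence on ℤ and agree at 0 and 1.
module Submission where

open import Defs
open import Data.Nat as ℕ using (ℕ; zero; suc; _/_)
open import Data.Nat.Combinatorics using (_C_; nCk+nC[k+1]≡[n+1]C[k+1])
open import Data.Nat.Combinatorics.Specification using (k>n⇒nCk≡0)
open import Data.Nat.Coprimality using (1-coprimeTo) renaming (sym to coprime-sym)
import Data.Nat.DivMod as ℕD
import Data.Nat.Properties as ℕP
import Data.Nat.Tactic.RingSolver as ℕS
open import Data.Integer as ℤ using (ℤ; +_; -[1+_])
import Data.Integer.Properties as ℤP
import Data.Integer.Tactic.RingSolver as ℤS
open import Algebra.Properties.AbelianGroup ℤP.+-0-abelianGroup using (∙-cancelˡ)
open import Data.Rational as ℚ using (ℚ; mkℚ)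
import Data.Rational.Properties as ℚP
open import Data.Rational.Solver using (module +-*-Solver)
open +-*-Solver using (solve; _:+_; _:*_; :-_; _:=_; con)
open import Data.Product using (_×_; _,_; proj₁)
open import Relation.Binary.PropositionalEquality

ι≡mkℚ : ∀ z → ι z ≡ mkℚ z 0 (coprime-sym (1-coprimeTo ℤ.∣ z ∣))
ι≡mkℚ (+ n)    = ℚP.normalize-coprime (coprime-sym (1-coprimeTo n))
ι≡mkℚ -[1+ n ] = cong ℚ.-_ (ℚP.normalize-coprime (coprime-sym (1-coprimeTo (suc n))))

ι-homo-+ : ∀ a b → ι (a ℤ.+ b) ≡ ι a ℚ.+ ι b
ι-homo-+ a b rewrite ι≡mkℚ a | ι≡mkℚ b =
  cong ι (sym (cong₂ ℤ._+_ (ℤP.*-identityʳ a) (ℤP.*-identityʳ b)))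

ι-homo-* : ∀ a b → ι (a ℤ.* b) ≡ ι a ℚ.* ι b
ι-homo-* a b rewrite ι≡mkℚ a | ι≡mkℚ b = refl

ι-homo‿- : ∀ a → ι (ℤ.- a) ≡ ℚ.- ι a
ι-homo‿- (+ zero)  = refl
ι-homo‿- (+ suc n) rewrite ι≡mkℚ (ℤ.- (+ suc n)) = refl
ι-homo‿- -[1+ n ]  rewrite ι≡mkℚ (+ suc n) = refl

record FibonacciLike (u : ℤ → ℤ) : Set where
  constructor fibonacciLike
  field
    recurrence : ∀ z → u (z ℤ.+ + 2) ≡ u (z ℤ.+ + 1) ℤ.+ u z

open FibonacciLike

-- At negative indices the sign (-1)ʲ alternates, so one ring identity covers the step.
private
  alternating : ∀ a b c → a ℤ.* b ≡ ℤ.- a ℤ.* (b ℤ.+ c) ℤ.+ ℤ.- (ℤ.- a) ℤ.* ((b ℤ.+ c) ℤ.+ b)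
  alternating = ℤS.solve-∀

F-fibonacciLike : FibonacciLike F
F-fibonacciLike = fibonacciLike F-rec
  where
  F-rec : ∀ z → F (z ℤ.+ + 2) ≡ F (z ℤ.+ + 1) ℤ.+ F z
  F-rec (+ n) rewrite ℕP.+-comm n 2 | ℕP.+-comm n 1 = refl
  F-rec -[1+ 0 ] = refl
  F-rec -[1+ 1 ] = refl
  F-rec -[1+ suc (suc k) ] = alternating (sgn k) (+ fibℕ (suc k)) (+ fibℕ k)

L-fibonacciLike : FibonacciLike L
L-fibonacciLike = fibonacciLike L-rec
  where
  L-rec : ∀ z → L (z ℤ.+ + 2) ≡ L (z ℤ.+ + 1) ℤ.+ L z
  L-rec (+ n) rewrite ℕP.+-comm n 2 | ℕP.+-comm n 1 = refl
  L-rec -[1+ 0 ] = refl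
  L-rec -[1+ 1 ] = refl
  L-rec -[1+ suc (suc k) ] = alternating (sgn (suc k)) (+ lucℕ (suc k)) (+ lucℕ k)

fibonacciLike-shift : ∀ {u} a → FibonacciLike u → FibonacciLike (λ z → u (z ℤ.+ a))
fibonacciLike-shift {u} a (fibonacciLike rec) = fibonacciLike λ z →
  trans (cong u (reassoc z (+ 2) a)) (trans (rec (z ℤ.+ a)) (cong (ℤ._+ u (z ℤ.+ a)) (cong u (sym (reassoc z (+ 1) a)))))
  where
  reassoc : ∀ z b a → (z ℤ.+ b) ℤ.+ a ≡ (z ℤ.+ a) ℤ.+ b
  reassoc = ℤS.solve-∀

fibonacciLike-+ : ∀ {u v} → FibonacciLike u → FibonacciLike v → FibonacciLike (λ z → u z ℤ.+ v z)
fibonacciLike-+ {u} {v} (fibonacciLike rec-u) (fibonacciLike rec-v) = fibonacciLike λ z →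
  trans (cong₂ ℤ._+_ (rec-u z) (rec-v z)) (interchange (u (z ℤ.+ + 1)) (u z) (v (z ℤ.+ + 1)) (v z))
  where
  interchange : ∀ a b c d → (a ℤ.+ b) ℤ.+ (c ℤ.+ d) ≡ (a ℤ.+ c) ℤ.+ (b ℤ.+ d)
  interchange = ℤS.solve-∀

fibonacciLike-scale : ∀ {u} c → FibonacciLike u → FibonacciLike (λ z → c ℤ.* u z)
fibonacciLike-scale {u} c (fibonacciLike rec) = fibonacciLike λ z →
  trans (cong (c ℤ.*_) (rec z)) (ℤP.*-distribˡ-+ c (u (z ℤ.+ + 1)) (u z))

module _ {u v : ℤ → ℤ} (fib-u : FibonacciLike u) (fib-v : FibonacciLike v) where

  private
    Agree : ℤ → Set
    Agree z = u z ≡ v z × u (z ℤ.+ + 1) ≡ v (z ℤ.+ + 1)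

    z+1+1≡z+2 : ∀ z → (z ℤ.+ + 1) ℤ.+ + 1 ≡ z ℤ.+ + 2
    z+1+1≡z+2 z = ℤP.+-assoc z (+ 1) (+ 1)

    agree-suc : ∀ z → Agree z → Agree (z ℤ.+ + 1)
    agree-suc z (p , q) = q , (begin
      u ((z ℤ.+ + 1) ℤ.+ + 1)   ≡⟨ cong u (z+1+1≡z+2 z) ⟩
      u (z ℤ.+ + 2)             ≡⟨ recurrence fib-u z ⟩
      u (z ℤ.+ + 1) ℤ.+ u z     ≡⟨ cong₂ ℤ._+_ q p ⟩
      v (z ℤ.+ + 1) ℤ.+ v z     ≡⟨ recurrence fib-v z ⟨
      v (z ℤ.+ + 2)             ≡⟨ cong v (z+1+1≡z+2 z) ⟨
      v ((z ℤ.+ + 1) ℤ.+ + 1)   ∎)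
      where open ≡-Reasoning

    agree-pred : ∀ z → Agree (z ℤ.+ + 1) → Agree z
    agree-pred z (q , r) = ∙-cancelˡ (v (z ℤ.+ + 1)) (u z) (v z) (begin
      v (z ℤ.+ + 1) ℤ.+ u z     ≡⟨ cong (ℤ._+ u z) q ⟨
      u (z ℤ.+ + 1) ℤ.+ u z     ≡⟨ recurrence fib-u z ⟨
      u (z ℤ.+ + 2)             ≡⟨ cong u (z+1+1≡z+2 z) ⟨
      u ((z ℤ.+ + 1) ℤ.+ + 1)   ≡⟨ r ⟩
      v ((z ℤ.+ + 1) ℤ.+ + 1)   ≡⟨ cong v (z+1+1≡z+2 z) ⟩
      v (z ℤ.+ + 2)             ≡⟨ recurrence fib-v z ⟩
      v (z ℤ.+ + 1) ℤ.+ v z     ∎) , q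
      where open ≡-Reasoning

  fibonacciLike-unique : u (+ 0) ≡ v (+ 0) → u (+ 1) ≡ v (+ 1) → ∀ z → u z ≡ v z
  fibonacciLike-unique p q z = proj₁ (agree z)
    where
    agree : ∀ z → Agree z
    agree (+ zero)     = p , q
    agree (+ suc n)    = subst Agree (cong +_ (ℕP.+-comm n 1)) (agree-suc (+ n) (agree (+ n)))
    agree -[1+ zero ]  = agree-pred -[1+ 0 ] (p , q)
    agree -[1+ suc n ] = agree-pred -[1+ suc n ] (agree -[1+ n ])

3F[m]+F[m+3]≡2L[m+1] : ∀ m → + 3 ℤ.* F m ℤ.+ F (m ℤ.+ + 3) ≡ + 2 ℤ.* L (m ℤ.+ + 1)
3F[m]+F[m+3]≡2L[m+1] = fibonacciLike-unique
  (fibonacciLike-+ (fibonacciLike-scale (+ 3) F-fibonacciLike) (fibonacciLike-shift (+ 3) F-fibonacciLike))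
  (fibonacciLike-scale (+ 2) (fibonacciLike-shift (+ 1) L-fibonacciLike))
  refl refl

3L[m]+L[m+3]≡10F[m+1] : ∀ m → + 3 ℤ.* L m ℤ.+ L (m ℤ.+ + 3) ≡ + 10 ℤ.* F (m ℤ.+ + 1)
3L[m]+L[m+3]≡10F[m+1] = fibonacciLike-unique
  (fibonacciLike-+ (fibonacciLike-scale (+ 3) L-fibonacciLike) (fibonacciLike-shift (+ 3) L-fibonacciLike))
  (fibonacciLike-scale (+ 10) (fibonacciLike-shift (+ 1) F-fibonacciLike))
  refl refl

3F[m]+F[m-3]≡2F[m+1] : ∀ m → + 3 ℤ.* F m ℤ.+ F (m ℤ.- + 3) ≡ + 2 ℤ.* F (m ℤ.+ + 1)
3F[m]+F[m-3]≡2F[m+1] = fibonacciLike-unique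
  (fibonacciLike-+ (fibonacciLike-scale (+ 3) F-fibonacciLike) (fibonacciLike-shift (ℤ.- + 3) F-fibonacciLike))
  (fibonacciLike-scale (+ 2) (fibonacciLike-shift (+ 1) F-fibonacciLike))
  refl refl

3L[m]+L[m-3]≡2L[m+1] : ∀ m → + 3 ℤ.* L m ℤ.+ L (m ℤ.- + 3) ≡ + 2 ℤ.* L (m ℤ.+ + 1)
3L[m]+L[m-3]≡2L[m+1] = fibonacciLike-unique
  (fibonacciLike-+ (fibonacciLike-scale (+ 3) L-fibonacciLike) (fibonacciLike-shift (ℤ.- + 3) L-fibonacciLike))
  (fibonacciLike-scale (+ 2) (fibonacciLike-shift (+ 1) L-fibonacciLike))
  refl refl

sgnℤ-suc : ∀ z → sgnℤ (z ℤ.+ + 1) ≡ ℤ.- sgnℤ z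
sgnℤ-suc (+ n) rewrite ℕP.+-comm n 1 = refl
sgnℤ-suc -[1+ zero ]  = refl
sgnℤ-suc -[1+ suc m ] = sym (ℤP.neg-involutive (sgn (suc m)))

sgnℤ-+3 : ∀ z → sgnℤ (z ℤ.+ + 3) ≡ ℤ.- sgnℤ z
sgnℤ-+3 z = begin
  sgnℤ (z ℤ.+ + 3)                             ≡⟨ cong sgnℤ (split z) ⟩
  sgnℤ (((z ℤ.+ + 1) ℤ.+ + 1) ℤ.+ + 1)          ≡⟨ sgnℤ-suc ((z ℤ.+ + 1) ℤ.+ + 1) ⟩
  ℤ.- sgnℤ ((z ℤ.+ + 1) ℤ.+ + 1)                ≡⟨ cong ℤ.-_ (sgnℤ-suc (z ℤ.+ + 1)) ⟩
  ℤ.- (ℤ.- sgnℤ (z ℤ.+ + 1))                    ≡⟨ ℤP.neg-involutive _ ⟩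
  sgnℤ (z ℤ.+ + 1)                             ≡⟨ sgnℤ-suc z ⟩
  ℤ.- sgnℤ z                                   ∎
  where
  open ≡-Reasoning
  split : ∀ z → z ℤ.+ + 3 ≡ ((z ℤ.+ + 1) ℤ.+ + 1) ℤ.+ + 1
  split = ℤS.solve-∀

sgn*sgn*x≡x : ∀ m x → sgn m ℤ.* (sgn m ℤ.* x) ≡ x
sgn*sgn*x≡x zero    x = trans (ℤP.*-identityˡ _) (ℤP.*-identityˡ x)
sgn*sgn*x≡x (suc m) x = trans (negate-twice (sgn m) x) (sgn*sgn*x≡x m x)
  where
  negate-twice : ∀ a x → ℤ.- a ℤ.* (ℤ.- a ℤ.* x) ≡ a ℤ.* (a ℤ.* x)
  negate-twice = ℤS.solve-∀

sgn[2q]≡1 : ∀ q → sgn (2 ℕ.* q) ≡ + 1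
sgn[2q]≡1 zero    = refl
sgn[2q]≡1 (suc q) = trans (cong sgn (ℕP.*-suc 2 q)) (trans (ℤP.neg-involutive _) (sgn[2q]≡1 q))

sgnℤ[s+1]*F[-s]≡F[s] : ∀ s → sgnℤ (s ℤ.+ + 1) ℤ.* F (+ 0 ℤ.- s) ≡ F s
sgnℤ[s+1]*F[-s]≡F[s] (+ zero)    = refl
sgnℤ[s+1]*F[-s]≡F[s] (+ suc m)   =
  trans (cong (ℤ._* F -[1+ m ]) (trans (sgnℤ-suc (+ suc m)) (ℤP.neg-involutive (sgn m)))) (sgn*sgn*x≡x m _)
sgnℤ[s+1]*F[-s]≡F[s] -[1+ zero ]  = refl
sgnℤ[s+1]*F[-s]≡F[s] -[1+ suc k ] = refl

sgnℤ[s]*L[-s]≡L[s] : ∀ s → sgnℤ s ℤ.* L (+ 0 ℤ.- s) ≡ L s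
sgnℤ[s]*L[-s]≡L[s] (+ zero)  = refl
sgnℤ[s]*L[-s]≡L[s] (+ suc m) = sgn*sgn*x≡x (suc m) _
sgnℤ[s]*L[-s]≡L[s] -[1+ m ]  = refl

sumTo-cong : ∀ m {f g : ℕ → ℚ} → (∀ j → f j ≡ g j) → sumTo m f ≡ sumTo m g
sumTo-cong zero    e = e 0
sumTo-cong (suc m) e = cong₂ ℚ._+_ (sumTo-cong m e) (e (suc m))

sumTo-+ : ∀ m f g → sumTo m (λ j → f j ℚ.+ g j) ≡ sumTo m f ℚ.+ sumTo m g
sumTo-+ zero    f g = refl
sumTo-+ (suc m) f g rewrite sumTo-+ m f g =
  solve 4 (λ a b c d → (a :+ b) :+ (c :+ d) := (a :+ c) :+ (b :+ d)) refl
    (sumTo m f) (sumTo m g) (f (suc m)) (g (suc m))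

sumTo-* : ∀ m c f → sumTo m (λ j → c ℚ.* f j) ≡ c ℚ.* sumTo m f
sumTo-* zero    c f = refl
sumTo-* (suc m) c f rewrite sumTo-* m c f = sym (ℚP.*-distribˡ-+ c (sumTo m f) (f (suc m)))

sumTo-suc : ∀ m f → sumTo (suc m) f ≡ f 0 ℚ.+ sumTo m (λ j → f (suc j))
sumTo-suc zero    f = refl
sumTo-suc (suc m) f rewrite sumTo-suc m f = ℚP.+-assoc (f 0) (sumTo m (λ j → f (suc j))) (f (suc (suc m)))

binomialSum : ℕ → (ℕ → ℚ) → ℚ
binomialSum n g = sumTo n (λ j → ι (+ (n C j)) ℚ.* g j)

binomialSum-head : ∀ n g → binomialSum n g ≡ g 0 ℚ.+ sumTo n (λ j → ι (+ (n C suc j)) ℚ.* g (suc j))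
binomialSum-head n g = begin
  binomialSum n g                                      ≡⟨ ℚP.+-identityʳ _ ⟨
  binomialSum n g ℚ.+ ℚ.0ℚ                             ≡⟨ cong (binomialSum n g ℚ.+_) (ℚP.*-zeroˡ (g (suc n))) ⟨
  binomialSum n g ℚ.+ ι (+ 0) ℚ.* g (suc n)            ≡⟨ cong (λ x → binomialSum n g ℚ.+ ι (+ x) ℚ.* g (suc n)) (k>n⇒nCk≡0 (ℕP.n<1+n n)) ⟨
  sumTo (suc n) (λ j → ι (+ (n C j)) ℚ.* g j)          ≡⟨ sumTo-suc n _ ⟩
  ι (+ 1) ℚ.* g 0 ℚ.+ tail                             ≡⟨ cong (ℚ._+ tail) (ℚP.*-identityˡ (g 0)) ⟩
  g 0 ℚ.+ tail                                         ∎
  where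
  open ≡-Reasoning
  tail : ℚ
  tail = sumTo n (λ j → ι (+ (n C suc j)) ℚ.* g (suc j))

binomialSum-suc : ∀ n g → binomialSum (suc n) g ≡ binomialSum n g ℚ.+ binomialSum n (λ j → g (suc j))
binomialSum-suc n g = begin
  binomialSum (suc n) g                                                 ≡⟨ sumTo-suc n _ ⟩
  ι (+ 1) ℚ.* g 0 ℚ.+ sumTo n (λ j → ι (+ (suc n C suc j)) ℚ.* g (suc j)) ≡⟨ cong₂ ℚ._+_ (ℚP.*-identityˡ (g 0)) (sumTo-cong n pascal) ⟩
  g 0 ℚ.+ sumTo n (λ j → ι (+ (n C j)) ℚ.* g (suc j) ℚ.+ ι (+ (n C suc j)) ℚ.* g (suc j))
                                                                        ≡⟨ cong (g 0 ℚ.+_) (sumTo-+ n _ _) ⟩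
  g 0 ℚ.+ (binomialSum n (λ j → g (suc j)) ℚ.+ tail)                    ≡⟨ solve 3 (λ a b c → a :+ (b :+ c) := (a :+ c) :+ b) refl (g 0) _ tail ⟩
  (g 0 ℚ.+ tail) ℚ.+ binomialSum n (λ j → g (suc j))                    ≡⟨ cong (ℚ._+ binomialSum n (λ j → g (suc j))) (binomialSum-head n g) ⟨
  binomialSum n g ℚ.+ binomialSum n (λ j → g (suc j))                   ∎
  where
  open ≡-Reasoning
  tail : ℚ
  tail = sumTo n (λ j → ι (+ (n C suc j)) ℚ.* g (suc j))
  pascal : ∀ j → ι (+ (suc n C suc j)) ℚ.* g (suc j) ≡ ι (+ (n C j)) ℚ.* g (suc j) ℚ.+ ι (+ (n C suc j)) ℚ.* g (suc j)
  pascal j = begin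
    ι (+ (suc n C suc j)) ℚ.* g (suc j)                          ≡⟨ cong (λ x → ι (+ x) ℚ.* g (suc j)) (nCk+nC[k+1]≡[n+1]C[k+1] n j) ⟨
    ι (+ (n C j) ℤ.+ + (n C suc j)) ℚ.* g (suc j)                ≡⟨ cong (ℚ._* g (suc j)) (ι-homo-+ (+ (n C j)) (+ (n C suc j))) ⟩
    (ι (+ (n C j)) ℚ.+ ι (+ (n C suc j))) ℚ.* g (suc j)          ≡⟨ ℚP.*-distribʳ-+ (g (suc j)) (ι (+ (n C j))) (ι (+ (n C suc j))) ⟩
    ι (+ (n C j)) ℚ.* g (suc j) ℚ.+ ι (+ (n C suc j)) ℚ.* g (suc j) ∎

binomialSum-* : ∀ n k f → binomialSum n (λ j → k ℚ.* f j) ≡ k ℚ.* binomialSum n f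
binomialSum-* n k f =
  trans (sumTo-cong n (λ j → solve 3 (λ a b c → a :* (b :* c) := b :* (a :* c)) refl (ι (+ (n C j))) k (f j)))
        (sumTo-* n k (λ j → ι (+ (n C j)) ℚ.* f j))

binomialSum-closedForm : {S : Set} (σ : S → S) (r k : ℚ) (w c : ℕ → S → ℚ) →
  (∀ j s → w (suc j) s ≡ k ℚ.* w j (σ s)) →
  (∀ s → w 0 s ≡ c 0 s) →
  (∀ n s → r ℚ.* c (suc n) s ≡ c n s ℚ.+ k ℚ.* c n (σ s)) →
  ∀ n s → binomialSum n (λ j → w j s) ≡ r ^ℚ n ℚ.* c n s
binomialSum-closedForm σ r k w c w-suc w-zero c-suc zero s =
  trans (ℚP.*-identityˡ (w 0 s)) (trans (w-zero s) (sym (ℚP.*-identityˡ (c 0 s))))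
binomialSum-closedForm σ r k w c w-suc w-zero c-suc (suc n) s = begin
  binomialSum (suc n) (λ j → w j s)                                ≡⟨ binomialSum-suc n _ ⟩
  binomialSum n (λ j → w j s) ℚ.+ binomialSum n (λ j → w (suc j) s) ≡⟨ cong (binomialSum n (λ j → w j s) ℚ.+_) shifted ⟩
  binomialSum n (λ j → w j s) ℚ.+ k ℚ.* binomialSum n (λ j → w j (σ s))
                                                                   ≡⟨ cong₂ (λ a b → a ℚ.+ k ℚ.* b) (closed s) (closed (σ s)) ⟩
  R ℚ.* c n s ℚ.+ k ℚ.* (R ℚ.* c n (σ s))                          ≡⟨ solve 4 (λ R a k b → R :* a :+ k :* (R :* b) := R :* (a :+ k :* b)) refl R (c n s) k (c n (σ s)) ⟩
  R ℚ.* (c n s ℚ.+ k ℚ.* c n (σ s))                                ≡⟨ cong (R ℚ.*_) (c-suc n s) ⟨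
  R ℚ.* (r ℚ.* c (suc n) s)                                        ≡⟨ solve 3 (λ R r c → R :* (r :* c) := (r :* R) :* c) refl R r (c (suc n) s) ⟩
  r ^ℚ suc n ℚ.* c (suc n) s                                       ∎
  where
  open ≡-Reasoning
  R : ℚ
  R = r ^ℚ n
  closed : ∀ s → binomialSum n (λ j → w j s) ≡ R ℚ.* c n s
  closed = binomialSum-closedForm σ r k w c w-suc w-zero c-suc n
  shifted : binomialSum n (λ j → w (suc j) s) ≡ k ℚ.* binomialSum n (λ j → w j (σ s))
  shifted = trans (sumTo-cong n (λ j → cong (ι (+ (n C j)) ℚ.*_) (w-suc j s))) (binomialSum-* n k _)

data ParityView : ℕ → Set where
  even : ∀ q → ParityView (2 ℕ.* q)
  odd  : ∀ q → ParityView (suc (2 ℕ.* q))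

parityView : ∀ n → ParityView n
parityView zero = even 0
parityView (suc n) with parityView n
... | even q = odd q
... | odd q  = subst ParityView (ℕP.*-suc 2 q) (even (suc q))

2q/2≡q : ∀ q → 2 ℕ.* q / 2 ≡ q
2q/2≡q q = trans (cong (_/ 2) (ℕP.*-comm 2 q)) (ℕD.m*n/n≡m q 2)

[1+2q]/2≡q : ∀ q → suc (2 ℕ.* q) / 2 ≡ q
[1+2q]/2≡q zero    = refl
[1+2q]/2≡q (suc q) = begin
  suc (2 ℕ.* suc q) / 2         ≡⟨ cong (λ m → suc m / 2) (ℕP.*-suc 2 q) ⟩
  suc (suc (suc (2 ℕ.* q))) / 2 ≡⟨ ℕD.m/n≡1+[m∸n]/n {suc (suc (suc (2 ℕ.* q)))} {2} (ℕ.s≤s (ℕ.s≤s ℕ.z≤n)) ⟩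
  suc (suc (2 ℕ.* q) / 2)       ≡⟨ cong suc ([1+2q]/2≡q q) ⟩
  suc q                         ∎
  where open ≡-Reasoning

if-parity-even : ∀ {A : Set} q (a b : A) → if-parity (2 ℕ.* q) a b ≡ a
if-parity-even zero    a b = refl
if-parity-even (suc q) a b = trans (cong (λ m → if-parity m a b) (ℕP.*-suc 2 q)) (if-parity-even q a b)

if-parity-odd : ∀ {A : Set} q (a b : A) → if-parity (suc (2 ℕ.* q)) a b ≡ b
if-parity-odd zero    a b = refl
if-parity-odd (suc q) a b = trans (cong (λ m → if-parity (suc m) a b) (ℕP.*-suc 2 q)) (if-parity-odd q a b)

if-parity-map : ∀ {A B : Set} (f : A → B) n a b → f (if-parity n a b) ≡ if-parity n (f a) (f b)
if-parity-map f zero          a b = refl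
if-parity-map f (suc zero)    a b = refl
if-parity-map f (suc (suc n)) a b = if-parity-map f n a b

module _ (H : ℕ → ℚ) where

  private
    G : ℕ → ℚ
    G j = H j ℚ.+ ι (sgn j) ℚ.* H j

    E : ℕ → ℚ
    E k = H (2 ℕ.* k)

    G-even : ∀ q → G (2 ℕ.* q) ≡ ι (+ 2) ℚ.* H (2 ℕ.* q)
    G-even q rewrite sgn[2q]≡1 q = solve 1 (λ x → x :+ con ℚ.1ℚ :* x := con (ι (+ 2)) :* x) refl (H (2 ℕ.* q))

    G-odd : ∀ q → G (suc (2 ℕ.* q)) ≡ ℚ.0ℚ
    G-odd q rewrite sgn[2q]≡1 q = solve 1 (λ x → x :+ con (ι (ℤ.- + 1)) :* x := con ℚ.0ℚ) refl (H (suc (2 ℕ.* q)))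

    evens : ∀ q → sumTo (2 ℕ.* q) G ≡ ι (+ 2) ℚ.* sumTo q E
    odds  : ∀ q → sumTo (suc (2 ℕ.* q)) G ≡ ι (+ 2) ℚ.* sumTo q E

    evens zero    = G-even 0
    evens (suc q) = begin
      sumTo (2 ℕ.* suc q) G                                   ≡⟨ cong (λ m → sumTo m G) (ℕP.*-suc 2 q) ⟩
      sumTo (suc (2 ℕ.* q)) G ℚ.+ G (suc (suc (2 ℕ.* q)))     ≡⟨ cong₂ ℚ._+_ (odds q) (trans (cong G (sym (ℕP.*-suc 2 q))) (G-even (suc q))) ⟩
      ι (+ 2) ℚ.* sumTo q E ℚ.+ ι (+ 2) ℚ.* E (suc q)         ≡⟨ ℚP.*-distribˡ-+ (ι (+ 2)) (sumTo q E) (E (suc q)) ⟨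
      ι (+ 2) ℚ.* sumTo (suc q) E                             ∎
      where open ≡-Reasoning
    odds q = trans (cong₂ ℚ._+_ (evens q) (G-odd q)) (ℚP.+-identityʳ _)

  sumTo-evenPart : ∀ n → sumTo n (λ j → H j ℚ.+ ι (sgn j) ℚ.* H j) ≡ ι (+ 2) ℚ.* sumTo (n / 2) (λ k → H (2 ℕ.* k))
  sumTo-evenPart n with parityView n
  ... | even q = trans (evens q) (cong (λ m → ι (+ 2) ℚ.* sumTo m E) (sym (2q/2≡q q)))
  ... | odd q  = trans (odds q) (cong (λ m → ι (+ 2) ℚ.* sumTo m E) (sym ([1+2q]/2≡q q)))

^ℚ-double : ∀ q k → q ^ℚ (2 ℕ.* k) ≡ (q ℚ.* q) ^ℚ k
^ℚ-double q zero    = refl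
^ℚ-double q (suc k) = begin
  q ^ℚ (2 ℕ.* suc k)                  ≡⟨ cong (q ^ℚ_) (ℕP.*-suc 2 k) ⟩
  q ℚ.* (q ℚ.* q ^ℚ (2 ℕ.* k))        ≡⟨ ℚP.*-assoc q q _ ⟨
  (q ℚ.* q) ℚ.* q ^ℚ (2 ℕ.* k)        ≡⟨ cong ((q ℚ.* q) ℚ.*_) (^ℚ-double q k) ⟩
  (q ℚ.* q) ℚ.* (q ℚ.* q) ^ℚ k        ∎
  where open ≡-Reasoning

-q^j≡sgn*q^j : ∀ q j → (ℚ.- q) ^ℚ j ≡ ι (sgn j) ℚ.* q ^ℚ j
-q^j≡sgn*q^j q zero    = refl
-q^j≡sgn*q^j q (suc j) = begin
  ℚ.- q ℚ.* (ℚ.- q) ^ℚ j                 ≡⟨ cong (ℚ.- q ℚ.*_) (-q^j≡sgn*q^j q j) ⟩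
  ℚ.- q ℚ.* (ι (sgn j) ℚ.* q ^ℚ j)       ≡⟨ solve 3 (λ q a p → (:- q) :* (a :* p) := (:- a) :* (q :* p)) refl q (ι (sgn j)) (q ^ℚ j) ⟩
  ℚ.- ι (sgn j) ℚ.* (q ℚ.* q ^ℚ j)       ≡⟨ cong (ℚ._* (q ℚ.* q ^ℚ j)) (ι-homo‿- (sgn j)) ⟨
  ι (sgn (suc j)) ℚ.* q ^ℚ suc j         ∎
  where open ≡-Reasoning

⅓ ⅔ ⅑ : ℚ
⅓ = ι (+ 1) ℚ.÷ ι (+ 3)
⅔ = ι (+ 2) ℚ.÷ ι (+ 3)
⅑ = ι (+ 1) ℚ.÷ ι (+ 9)

weighted : (ℤ → ℤ) → ℚ → ℕ → ℤ → ℚ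
weighted h τ j s = ι (h (+ (3 ℕ.* j) ℤ.+ s)) ℚ.* τ ^ℚ j

weighted-zero : ∀ h τ s → weighted h τ 0 s ≡ ι (h s)
weighted-zero h τ s = trans (ℚP.*-identityʳ _) (cong (λ z → ι (h z)) (ℤP.+-identityˡ s))

weighted-suc : ∀ h τ j s → weighted h τ (suc j) s ≡ τ ℚ.* weighted h τ j (s ℤ.+ + 3)
weighted-suc h τ j s = begin
  ι (h (+ (3 ℕ.* suc j) ℤ.+ s)) ℚ.* (τ ℚ.* τ ^ℚ j)        ≡⟨ cong (λ z → ι (h z) ℚ.* (τ ℚ.* τ ^ℚ j)) index ⟩
  ι (h (+ (3 ℕ.* j) ℤ.+ (s ℤ.+ + 3))) ℚ.* (τ ℚ.* τ ^ℚ j)  ≡⟨ solve 3 (λ a t p → a :* (t :* p) := t :* (a :* p)) refl (ι (h (+ (3 ℕ.* j) ℤ.+ (s ℤ.+ + 3)))) τ (τ ^ℚ j) ⟩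
  τ ℚ.* weighted h τ j (s ℤ.+ + 3)                         ∎
  where
  open ≡-Reasoning
  move : ∀ a s → (+ 3 ℤ.+ a) ℤ.+ s ≡ a ℤ.+ (s ℤ.+ + 3)
  move = ℤS.solve-∀
  index : + (3 ℕ.* suc j) ℤ.+ s ≡ + (3 ℕ.* j) ℤ.+ (s ℤ.+ + 3)
  index = trans (cong (λ k → + k ℤ.+ s) (ℕP.*-suc 3 j)) (move (+ (3 ℕ.* j)) s)

weighted-neg : ∀ h τ j s → weighted h (ℚ.- τ) j s ≡ ι (sgn j) ℚ.* weighted h τ j s
weighted-neg h τ j s = trans (cong (ι (h (+ (3 ℕ.* j) ℤ.+ s)) ℚ.*_) (-q^j≡sgn*q^j τ j))
  (solve 3 (λ a b c → a :* (b :* c) := b :* (a :* c)) refl (ι (h (+ (3 ℕ.* j) ℤ.+ s))) (ι (sgn j)) (τ ^ℚ j))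

⅔-step : ∀ c c′ e → + 2 ℤ.* c′ ≡ + 3 ℤ.* c ℤ.+ e → ⅔ ℚ.* ι c′ ≡ ι c ℚ.+ ⅓ ℚ.* ι e
⅔-step c c′ e step = begin
  ⅔ ℚ.* ι c′                              ≡⟨ cong (ℚ._* ι c′) ⅔≡2*⅓ ⟩
  (ι (+ 2) ℚ.* ⅓) ℚ.* ι c′                ≡⟨ solve 3 (λ x t c → (x :* t) :* c := t :* (x :* c)) refl (ι (+ 2)) ⅓ (ι c′) ⟩
  ⅓ ℚ.* (ι (+ 2) ℚ.* ι c′)                ≡⟨ cong (⅓ ℚ.*_) (ι-homo-* (+ 2) c′) ⟨
  ⅓ ℚ.* ι (+ 2 ℤ.* c′)                    ≡⟨ cong (λ x → ⅓ ℚ.* ι x) step ⟩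
  ⅓ ℚ.* ι (+ 3 ℤ.* c ℤ.+ e)               ≡⟨ cong (⅓ ℚ.*_) (trans (ι-homo-+ (+ 3 ℤ.* c) e) (cong (ℚ._+ ι e) (ι-homo-* (+ 3) c))) ⟩
  ⅓ ℚ.* (ι (+ 3) ℚ.* ι c ℚ.+ ι e)         ≡⟨ solve 4 (λ t x a b → t :* (x :* a :+ b) := (x :* t) :* a :+ t :* b) refl ⅓ (ι (+ 3)) (ι c) (ι e) ⟩
  (ι (+ 3) ℚ.* ⅓) ℚ.* ι c ℚ.+ ⅓ ℚ.* ι e   ≡⟨ cong (λ x → x ℚ.* ι c ℚ.+ ⅓ ℚ.* ι e) 3*⅓≡1 ⟩
  ℚ.1ℚ ℚ.* ι c ℚ.+ ⅓ ℚ.* ι e              ≡⟨ cong (ℚ._+ ⅓ ℚ.* ι e) (ℚP.*-identityˡ (ι c)) ⟩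
  ι c ℚ.+ ⅓ ℚ.* ι e                       ∎
  where
  open ≡-Reasoning
  ⅔≡2*⅓ : ⅔ ≡ ι (+ 2) ℚ.* ⅓
  ⅔≡2*⅓ = refl
  3*⅓≡1 : ι (+ 3) ℚ.* ⅓ ≡ ℚ.1ℚ
  3*⅓≡1 = refl

evenBinomialSum : (ℤ → ℤ) → ℕ → ℤ → ℚ
evenBinomialSum h n s =
  ι (+ 2) ℚ.* sumTo (n / 2) (λ k → ι (+ (n C (2 ℕ.* k)) ℤ.* h (+ (6 ℕ.* k) ℤ.+ s)) ℚ.* ⅑ ^ℚ k)

module ClosedForm
  (h : ℤ → ℤ) (c d : ℕ → ℤ → ℤ)
  (c-zero : ∀ s → c 0 s ≡ h s)
  (c-step : ∀ n s → + 2 ℤ.* c (suc n) s ≡ + 3 ℤ.* c n s ℤ.+ c n (s ℤ.+ + 3))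
  (d-zero : ∀ s → d 0 s ≡ h s)
  (d-step : ∀ n s → + 2 ℤ.* d (suc n) s ≡ + 3 ℤ.* d n s ℤ.- d n (s ℤ.+ + 3))
  where

  binomialSum-⅓ : ∀ n s → binomialSum n (λ j → weighted h ⅓ j s) ≡ ⅔ ^ℚ n ℚ.* ι (c n s)
  binomialSum-⅓ = binomialSum-closedForm (ℤ._+ + 3) ⅔ ⅓ (weighted h ⅓) (λ n s → ι (c n s))
    (weighted-suc h ⅓)
    (λ s → trans (weighted-zero h ⅓ s) (cong ι (sym (c-zero s))))
    (λ n s → ⅔-step (c n s) (c (suc n) s) (c n (s ℤ.+ + 3)) (c-step n s))

  binomialSum-−⅓ : ∀ n s → binomialSum n (λ j → weighted h (ℚ.- ⅓) j s) ≡ ⅔ ^ℚ n ℚ.* ι (d n s)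
  binomialSum-−⅓ = binomialSum-closedForm (ℤ._+ + 3) ⅔ (ℚ.- ⅓) (weighted h (ℚ.- ⅓)) (λ n s → ι (d n s))
    (weighted-suc h (ℚ.- ⅓))
    (λ s → trans (weighted-zero h (ℚ.- ⅓) s) (cong ι (sym (d-zero s))))
    (λ n s → trans (⅔-step (d n s) (d (suc n) s) (ℤ.- d n (s ℤ.+ + 3)) (d-step n s)) (cong (ι (d n s) ℚ.+_) (negate (d n (s ℤ.+ + 3)))))
    where
    negate : ∀ e → ⅓ ℚ.* ι (ℤ.- e) ≡ ℚ.- ⅓ ℚ.* ι e
    negate e = trans (cong (⅓ ℚ.*_) (ι-homo‿- e)) (solve 2 (λ t x → t :* (:- x) := (:- t) :* x) refl ⅓ (ι e))

  evenBinomialSum≡ : ∀ n s → evenBinomialSum h n s ≡ ⅔ ^ℚ n ℚ.* ι (d n s ℤ.+ c n s)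
  evenBinomialSum≡ n s = begin
    evenBinomialSum h n s                                      ≡⟨ cong (ι (+ 2) ℚ.*_) (sumTo-cong (n / 2) even-term) ⟩
    ι (+ 2) ℚ.* sumTo (n / 2) (λ k → H (2 ℕ.* k))              ≡⟨ sumTo-evenPart H n ⟨
    sumTo n (λ j → H j ℚ.+ ι (sgn j) ℚ.* H j)                  ≡⟨ sumTo-cong n signed-term ⟩
    sumTo n (λ j → H j ℚ.+ ι (+ (n C j)) ℚ.* weighted h (ℚ.- ⅓) j s)
                                                               ≡⟨ sumTo-+ n _ _ ⟩
    binomialSum n (λ j → weighted h ⅓ j s) ℚ.+ binomialSum n (λ j → weighted h (ℚ.- ⅓) j s)
                                                               ≡⟨ cong₂ ℚ._+_ (binomialSum-⅓ n s) (binomialSum-−⅓ n s) ⟩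
    ⅔ ^ℚ n ℚ.* ι (c n s) ℚ.+ ⅔ ^ℚ n ℚ.* ι (d n s)              ≡⟨ solve 3 (λ r x y → r :* x :+ r :* y := r :* (y :+ x)) refl (⅔ ^ℚ n) (ι (c n s)) (ι (d n s)) ⟩
    ⅔ ^ℚ n ℚ.* (ι (d n s) ℚ.+ ι (c n s))                       ≡⟨ cong (⅔ ^ℚ n ℚ.*_) (ι-homo-+ (d n s) (c n s)) ⟨
    ⅔ ^ℚ n ℚ.* ι (d n s ℤ.+ c n s)                             ∎
    where
    open ≡-Reasoning
    H : ℕ → ℚ
    H j = ι (+ (n C j)) ℚ.* weighted h ⅓ j s

    6k≡3[2k] : ∀ k → 6 ℕ.* k ≡ 3 ℕ.* (2 ℕ.* k)
    6k≡3[2k] = ℕS.solve-∀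

    even-term : ∀ k → ι (+ (n C (2 ℕ.* k)) ℤ.* h (+ (6 ℕ.* k) ℤ.+ s)) ℚ.* ⅑ ^ℚ k ≡ H (2 ℕ.* k)
    even-term k = begin
      ι (+ (n C (2 ℕ.* k)) ℤ.* h (+ (6 ℕ.* k) ℤ.+ s)) ℚ.* ⅑ ^ℚ k
        ≡⟨ cong (ℚ._* ⅑ ^ℚ k) (ι-homo-* (+ (n C (2 ℕ.* k))) _) ⟩
      (ι (+ (n C (2 ℕ.* k))) ℚ.* ι (h (+ (6 ℕ.* k) ℤ.+ s))) ℚ.* ⅑ ^ℚ k
        ≡⟨ ℚP.*-assoc (ι (+ (n C (2 ℕ.* k)))) _ _ ⟩
      ι (+ (n C (2 ℕ.* k))) ℚ.* (ι (h (+ (6 ℕ.* k) ℤ.+ s)) ℚ.* ⅑ ^ℚ k)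
        ≡⟨ cong₂ (λ i p → ι (+ (n C (2 ℕ.* k))) ℚ.* (ι (h (+ i ℤ.+ s)) ℚ.* p)) (6k≡3[2k] k) (sym (^ℚ-double ⅓ k)) ⟩
      H (2 ℕ.* k) ∎

    signed-term : ∀ j → H j ℚ.+ ι (sgn j) ℚ.* H j ≡ H j ℚ.+ ι (+ (n C j)) ℚ.* weighted h (ℚ.- ⅓) j s
    signed-term j = cong (H j ℚ.+_) (begin
      ι (sgn j) ℚ.* (ι (+ (n C j)) ℚ.* weighted h ⅓ j s)  ≡⟨ solve 3 (λ a b c → a :* (b :* c) := b :* (a :* c)) refl (ι (sgn j)) (ι (+ (n C j))) (weighted h ⅓ j s) ⟩
      ι (+ (n C j)) ℚ.* (ι (sgn j) ℚ.* weighted h ⅓ j s)  ≡⟨ cong (ι (+ (n C j)) ℚ.*_) (weighted-neg h ⅓ j s) ⟨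
      ι (+ (n C j)) ℚ.* weighted h (ℚ.- ⅓) j s            ∎)

module ParityCoefficients
  (h h′ : ℤ → ℤ) (c : ℕ → ℤ → ℤ)
  (c-even : ∀ q s → c (2 ℕ.* q) s ≡ + (5 ℕ.^ q) ℤ.* h (+ (2 ℕ.* q) ℤ.+ s))
  (c-odd  : ∀ q s → c (suc (2 ℕ.* q)) s ≡ + (5 ℕ.^ q) ℤ.* h′ (+ suc (2 ℕ.* q) ℤ.+ s))
  (h→h′ : ∀ m → + 3 ℤ.* h m ℤ.+ h (m ℤ.+ + 3) ≡ + 2 ℤ.* h′ (m ℤ.+ + 1))
  (h′→h : ∀ m → + 3 ℤ.* h′ m ℤ.+ h′ (m ℤ.+ + 3) ≡ + 10 ℤ.* h (m ℤ.+ + 1))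
  where

  private
    scaled : ∀ {a b e x y z} p → a ≡ p ℤ.* x → b ≡ p ℤ.* y → e ≡ p ℤ.* z →
             + 2 ℤ.* x ≡ + 3 ℤ.* y ℤ.+ z → + 2 ℤ.* a ≡ + 3 ℤ.* b ℤ.+ e
    scaled {x = x} {y} {z} p refl refl refl step =
      trans (commute p x) (trans (cong (p ℤ.*_) step) (distribute p y z))
      where
      commute : ∀ p x → + 2 ℤ.* (p ℤ.* x) ≡ p ℤ.* (+ 2 ℤ.* x)
      commute = ℤS.solve-∀
      distribute : ∀ p y z → p ℤ.* (+ 3 ℤ.* y ℤ.+ z) ≡ + 3 ℤ.* (p ℤ.* y) ℤ.+ p ℤ.* z
      distribute = ℤS.solve-∀

    +suc[k]+s : ∀ k s → + suc k ℤ.+ s ≡ (+ k ℤ.+ s) ℤ.+ + 1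
    +suc[k]+s k s = move (+ k) s
      where
      move : ∀ a s → (+ 1 ℤ.+ a) ℤ.+ s ≡ (a ℤ.+ s) ℤ.+ + 1
      move = ℤS.solve-∀

    +k+[s+3] : ∀ k s → + k ℤ.+ (s ℤ.+ + 3) ≡ (+ k ℤ.+ s) ℤ.+ + 3
    +k+[s+3] k s = sym (ℤP.+-assoc (+ k) s (+ 3))

  parityCoefficient-zero : ∀ s → c 0 s ≡ h s
  parityCoefficient-zero s = trans (c-even 0 s) (trans (ℤP.*-identityˡ _) (cong h (ℤP.+-identityˡ s)))

  parityCoefficient-step : ∀ n s → + 2 ℤ.* c (suc n) s ≡ + 3 ℤ.* c n s ℤ.+ c n (s ℤ.+ + 3)
  parityCoefficient-step n s with parityView n
  ... | even q = scaled (+ (5 ℕ.^ q)) (c-odd q s) (c-even q s) (c-even q (s ℤ.+ + 3)) (begin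
    + 2 ℤ.* h′ (+ suc (2 ℕ.* q) ℤ.+ s)            ≡⟨ cong (λ i → + 2 ℤ.* h′ i) (+suc[k]+s (2 ℕ.* q) s) ⟩
    + 2 ℤ.* h′ (m ℤ.+ + 1)                        ≡⟨ h→h′ m ⟨
    + 3 ℤ.* h m ℤ.+ h (m ℤ.+ + 3)                 ≡⟨ cong (λ i → + 3 ℤ.* h m ℤ.+ h i) (+k+[s+3] (2 ℕ.* q) s) ⟨
    + 3 ℤ.* h m ℤ.+ h (+ (2 ℕ.* q) ℤ.+ (s ℤ.+ + 3)) ∎)
    where
    open ≡-Reasoning
    m : ℤ
    m = + (2 ℕ.* q) ℤ.+ s
  ... | odd q = scaled (+ (5 ℕ.^ q)) c-next (c-odd q s) (c-odd q (s ℤ.+ + 3)) (begin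
    + 2 ℤ.* (+ 5 ℤ.* h (+ suc (suc (2 ℕ.* q)) ℤ.+ s)) ≡⟨ cong (λ i → + 2 ℤ.* (+ 5 ℤ.* h i)) (+suc[k]+s (suc (2 ℕ.* q)) s) ⟩
    + 2 ℤ.* (+ 5 ℤ.* h (m ℤ.+ + 1))                   ≡⟨ ten (h (m ℤ.+ + 1)) ⟩
    + 10 ℤ.* h (m ℤ.+ + 1)                            ≡⟨ h′→h m ⟨
    + 3 ℤ.* h′ m ℤ.+ h′ (m ℤ.+ + 3)                   ≡⟨ cong (λ i → + 3 ℤ.* h′ m ℤ.+ h′ i) (+k+[s+3] (suc (2 ℕ.* q)) s) ⟨
    + 3 ℤ.* h′ m ℤ.+ h′ (+ suc (2 ℕ.* q) ℤ.+ (s ℤ.+ + 3)) ∎)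
    where
    open ≡-Reasoning
    m : ℤ
    m = + suc (2 ℕ.* q) ℤ.+ s
    ten : ∀ x → + 2 ℤ.* (+ 5 ℤ.* x) ≡ + 10 ℤ.* x
    ten = ℤS.solve-∀
    rearrange : ∀ a x → (+ 5 ℤ.* a) ℤ.* x ≡ a ℤ.* (+ 5 ℤ.* x)
    rearrange = ℤS.solve-∀
    c-next : c (suc (suc (2 ℕ.* q))) s ≡ + (5 ℕ.^ q) ℤ.* (+ 5 ℤ.* h (+ suc (suc (2 ℕ.* q)) ℤ.+ s))
    c-next = begin
      c (suc (suc (2 ℕ.* q))) s                              ≡⟨ cong (λ k → c k s) (ℕP.*-suc 2 q) ⟨
      c (2 ℕ.* suc q) s                                      ≡⟨ c-even (suc q) s ⟩
      + (5 ℕ.^ suc q) ℤ.* h (+ (2 ℕ.* suc q) ℤ.+ s)           ≡⟨ cong (λ k → + (5 ℕ.^ suc q) ℤ.* h (+ k ℤ.+ s)) (ℕP.*-suc 2 q) ⟩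
      + (5 ℕ.^ suc q) ℤ.* h (+ suc (suc (2 ℕ.* q)) ℤ.+ s)     ≡⟨ cong (ℤ._* h (+ suc (suc (2 ℕ.* q)) ℤ.+ s)) (ℤP.pos-* 5 (5 ℕ.^ q)) ⟩
      (+ 5 ℤ.* + (5 ℕ.^ q)) ℤ.* h (+ suc (suc (2 ℕ.* q)) ℤ.+ s) ≡⟨ rearrange (+ (5 ℕ.^ q)) _ ⟩
      + (5 ℕ.^ q) ℤ.* (+ 5 ℤ.* h (+ suc (suc (2 ℕ.* q)) ℤ.+ s)) ∎

reflected-step : (σ h : ℤ → ℤ) → (∀ s → σ (s ℤ.+ + 3) ≡ ℤ.- σ s) →
  (∀ m → + 3 ℤ.* h m ℤ.+ h (m ℤ.- + 3) ≡ + 2 ℤ.* h (m ℤ.+ + 1)) →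
  ∀ n s → + 2 ℤ.* (σ s ℤ.* h (+ suc n ℤ.- s)) ≡
          + 3 ℤ.* (σ s ℤ.* h (+ n ℤ.- s)) ℤ.- σ (s ℤ.+ + 3) ℤ.* h (+ n ℤ.- (s ℤ.+ + 3))
reflected-step σ h σ-+3 identity n s = begin
  + 2 ℤ.* (σ s ℤ.* h (+ suc n ℤ.- s))                 ≡⟨ cong (λ i → + 2 ℤ.* (σ s ℤ.* h i)) (suc-index (+ n) s) ⟩
  + 2 ℤ.* (σ s ℤ.* h (m ℤ.+ + 1))                     ≡⟨ commute (σ s) (h (m ℤ.+ + 1)) ⟩
  σ s ℤ.* (+ 2 ℤ.* h (m ℤ.+ + 1))                     ≡⟨ cong (σ s ℤ.*_) (identity m) ⟨
  σ s ℤ.* (+ 3 ℤ.* h m ℤ.+ h (m ℤ.- + 3))             ≡⟨ distribute (σ s) (h m) (h (m ℤ.- + 3)) ⟩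
  + 3 ℤ.* (σ s ℤ.* h m) ℤ.- ℤ.- σ s ℤ.* h (m ℤ.- + 3)  ≡⟨ cong₂ (λ a i → + 3 ℤ.* (σ s ℤ.* h m) ℤ.- a ℤ.* h i) (σ-+3 s) (sub-index (+ n) s) ⟨
  + 3 ℤ.* (σ s ℤ.* h m) ℤ.- σ (s ℤ.+ + 3) ℤ.* h (+ n ℤ.- (s ℤ.+ + 3)) ∎
  where
  open ≡-Reasoning
  m : ℤ
  m = + n ℤ.- s
  suc-index : ∀ a s → (+ 1 ℤ.+ a) ℤ.- s ≡ (a ℤ.- s) ℤ.+ + 1
  suc-index = ℤS.solve-∀
  sub-index : ∀ a s → a ℤ.- (s ℤ.+ + 3) ≡ (a ℤ.- s) ℤ.- + 3
  sub-index = ℤS.solve-∀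
  commute : ∀ p x → + 2 ℤ.* (p ℤ.* x) ≡ p ℤ.* (+ 2 ℤ.* x)
  commute = ℤS.solve-∀
  distribute : ∀ p y z → p ℤ.* (+ 3 ℤ.* y ℤ.+ z) ≡ + 3 ℤ.* (p ℤ.* y) ℤ.- ℤ.- p ℤ.* z
  distribute = ℤS.solve-∀

cF cL dF dL : ℕ → ℤ → ℤ
cF n s = if-parity n (+ (5 ℕ.^ (n / 2)) ℤ.* F (+ n ℤ.+ s)) (+ (5 ℕ.^ ((n ℕ.∸ 1) / 2)) ℤ.* L (+ n ℤ.+ s))
cL n s = if-parity n (+ (5 ℕ.^ (n / 2)) ℤ.* L (+ n ℤ.+ s)) (+ (5 ℕ.^ ((n ℕ.+ 1) / 2)) ℤ.* F (+ n ℤ.+ s))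
dF n s = sgnℤ (s ℤ.+ + 1) ℤ.* F (+ n ℤ.- s)
dL n s = sgnℤ s ℤ.* L (+ n ℤ.- s)

cF-even : ∀ q s → cF (2 ℕ.* q) s ≡ + (5 ℕ.^ q) ℤ.* F (+ (2 ℕ.* q) ℤ.+ s)
cF-even q s = trans (if-parity-even q _ _) (cong (λ k → + (5 ℕ.^ k) ℤ.* F (+ (2 ℕ.* q) ℤ.+ s)) (2q/2≡q q))

cF-odd : ∀ q s → cF (suc (2 ℕ.* q)) s ≡ + (5 ℕ.^ q) ℤ.* L (+ suc (2 ℕ.* q) ℤ.+ s)
cF-odd q s = trans (if-parity-odd q _ _) (cong (λ k → + (5 ℕ.^ k) ℤ.* L (+ suc (2 ℕ.* q) ℤ.+ s)) (2q/2≡q q))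

cL-even : ∀ q s → cL (2 ℕ.* q) s ≡ + (5 ℕ.^ q) ℤ.* L (+ (2 ℕ.* q) ℤ.+ s)
cL-even q s = trans (if-parity-even q _ _) (cong (λ k → + (5 ℕ.^ k) ℤ.* L (+ (2 ℕ.* q) ℤ.+ s)) (2q/2≡q q))

cL-odd : ∀ q s → cL (suc (2 ℕ.* q)) s ≡ + (5 ℕ.^ q) ℤ.* (+ 5 ℤ.* F (+ suc (2 ℕ.* q) ℤ.+ s))
cL-odd q s = trans (if-parity-odd q _ _) (begin
  + (5 ℕ.^ ((suc (2 ℕ.* q) ℕ.+ 1) / 2)) ℤ.* F X  ≡⟨ cong (λ k → + (5 ℕ.^ k) ℤ.* F X) half ⟩
  + (5 ℕ.^ suc q) ℤ.* F X                        ≡⟨ cong (ℤ._* F X) (ℤP.pos-* 5 (5 ℕ.^ q)) ⟩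
  (+ 5 ℤ.* + (5 ℕ.^ q)) ℤ.* F X                  ≡⟨ rearrange (+ (5 ℕ.^ q)) (F X) ⟩
  + (5 ℕ.^ q) ℤ.* (+ 5 ℤ.* F X)                  ∎)
  where
  open ≡-Reasoning
  X : ℤ
  X = + suc (2 ℕ.* q) ℤ.+ s
  [1+2q]+1≡2[1+q] : ∀ q → suc (2 ℕ.* q) ℕ.+ 1 ≡ 2 ℕ.* suc q
  [1+2q]+1≡2[1+q] = ℕS.solve-∀
  half : (suc (2 ℕ.* q) ℕ.+ 1) / 2 ≡ suc q
  half = trans (cong (_/ 2) ([1+2q]+1≡2[1+q] q)) (2q/2≡q (suc q))
  rearrange : ∀ a x → (+ 5 ℤ.* a) ℤ.* x ≡ a ℤ.* (+ 5 ℤ.* x)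
  rearrange = ℤS.solve-∀

3L[m]+L[m+3]≡2[5F[m+1]] : ∀ m → + 3 ℤ.* L m ℤ.+ L (m ℤ.+ + 3) ≡ + 2 ℤ.* (+ 5 ℤ.* F (m ℤ.+ + 1))
3L[m]+L[m+3]≡2[5F[m+1]] m = trans (3L[m]+L[m+3]≡10F[m+1] m) (split (F (m ℤ.+ + 1)))
  where
  split : ∀ x → + 10 ℤ.* x ≡ + 2 ℤ.* (+ 5 ℤ.* x)
  split = ℤS.solve-∀

3[5F[m]]+5F[m+3]≡10L[m+1] : ∀ m → + 3 ℤ.* (+ 5 ℤ.* F m) ℤ.+ + 5 ℤ.* F (m ℤ.+ + 3) ≡ + 10 ℤ.* L (m ℤ.+ + 1)
3[5F[m]]+5F[m+3]≡10L[m+1] m =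
  trans (factor (F m) (F (m ℤ.+ + 3))) (trans (cong (+ 5 ℤ.*_) (3F[m]+F[m+3]≡2L[m+1] m)) (collect (L (m ℤ.+ + 1))))
  where
  factor : ∀ x y → + 3 ℤ.* (+ 5 ℤ.* x) ℤ.+ + 5 ℤ.* y ≡ + 5 ℤ.* (+ 3 ℤ.* x ℤ.+ y)
  factor = ℤS.solve-∀
  collect : ∀ x → + 5 ℤ.* (+ 2 ℤ.* x) ≡ + 10 ℤ.* x
  collect = ℤS.solve-∀

dF-step : ∀ n s → + 2 ℤ.* dF (suc n) s ≡ + 3 ℤ.* dF n s ℤ.- dF n (s ℤ.+ + 3)
dF-step = reflected-step (λ s → sgnℤ (s ℤ.+ + 1)) F sgn-+3 3F[m]+F[m-3]≡2F[m+1]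
  where
  swap : ∀ s → (s ℤ.+ + 3) ℤ.+ + 1 ≡ (s ℤ.+ + 1) ℤ.+ + 3
  swap = ℤS.solve-∀
  sgn-+3 : ∀ s → sgnℤ ((s ℤ.+ + 3) ℤ.+ + 1) ≡ ℤ.- sgnℤ (s ℤ.+ + 1)
  sgn-+3 s = trans (cong sgnℤ (swap s)) (sgnℤ-+3 (s ℤ.+ + 1))

dL-step : ∀ n s → + 2 ℤ.* dL (suc n) s ≡ + 3 ℤ.* dL n s ℤ.- dL n (s ℤ.+ + 3)
dL-step = reflected-step sgnℤ L sgnℤ-+3 3L[m]+L[m-3]≡2L[m+1]

open ParityCoefficients F L cF cF-even cF-odd 3F[m]+F[m+3]≡2L[m+1] 3L[m]+L[m+3]≡10F[m+1]
  renaming (parityCoefficient-zero to cF-zero; parityCoefficient-step to cF-step)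

-- For h = L the odd-index coefficients 5^((n+1)/2) F(n+s) carry an extra 5, absorbed into h′ = 5F.
open ParityCoefficients L (λ z → + 5 ℤ.* F z) cL cL-even cL-odd 3L[m]+L[m+3]≡2[5F[m+1]] 3[5F[m]]+5F[m+3]≡10L[m+1]
  renaming (parityCoefficient-zero to cL-zero; parityCoefficient-step to cL-step)

evenBinomialSum-F : ∀ n s → evenBinomialSum F n s ≡ ⅔ ^ℚ n ℚ.* ι (dF n s ℤ.+ cF n s)
evenBinomialSum-F = ClosedForm.evenBinomialSum≡ F cF dF cF-zero cF-step sgnℤ[s+1]*F[-s]≡F[s] dF-step

evenBinomialSum-L : ∀ n s → evenBinomialSum L n s ≡ ⅔ ^ℚ n ℚ.* ι (dL n s ℤ.+ cL n s)
evenBinomialSum-L = ClosedForm.evenBinomialSum≡ L cL dL cL-zero cL-step sgnℤ[s]*L[-s]≡L[s] dL-step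

theorem13 : (n : ℕ) (s : ℤ) →
    (ι (+ 2) ℚ.* sumTo (n / 2) (λ k → ι (+ (n C (2 ℕ.* k)) ℤ.* F (+ (6 ℕ.* k) ℤ.+ s)) ℚ.* ((ι (+ 1) ℚ.÷ ι (+ 9)) ^ℚ k))
      ≡ (ι (+ 2) ℚ.÷ ι (+ 3)) ^ℚ n ℚ.*
        (if-parity n
          (ι (sgnℤ (s ℤ.+ + 1) ℤ.* F (+ n ℤ.- s) ℤ.+ + (5 ℕ.^ (n / 2)) ℤ.* F (+ n ℤ.+ s)))
          (ι (sgnℤ (s ℤ.+ + 1) ℤ.* F (+ n ℤ.- s) ℤ.+ + (5 ℕ.^ ((n ℕ.∸ 1) / 2)) ℤ.* L (+ n ℤ.+ s)))))
    ×
    (ι (+ 2) ℚ.* sumTo (n / 2) (λ k → ι (+ (n C (2 ℕ.* k)) ℤ.* L (+ (6 ℕ.* k) ℤ.+ s)) ℚ.* ((ι (+ 1) ℚ.÷ ι (+ 9)) ^ℚ k))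
      ≡ (ι (+ 2) ℚ.÷ ι (+ 3)) ^ℚ n ℚ.*
        (if-parity n
          (ι (sgnℤ s ℤ.* L (+ n ℤ.- s) ℤ.+ + (5 ℕ.^ (n / 2)) ℤ.* L (+ n ℤ.+ s)))
          (ι (sgnℤ s ℤ.* L (+ n ℤ.- s) ℤ.+ + (5 ℕ.^ ((n ℕ.+ 1) / 2)) ℤ.* F (+ n ℤ.+ s)))))
theorem13 n s =
  trans (evenBinomialSum-F n s) (cong (⅔ ^ℚ n ℚ.*_) (if-parity-map (λ x → ι (dF n s ℤ.+ x)) n _ _)) ,
  trans (evenBinomialSum-L n s) (cong (⅔ ^ℚ n ℚ.*_) (if-parity-map (λ x → ι (dL n s ℤ.+ x)) n _ _))
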